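{- There is an fpt-reduction from $p_{\alpha,d}$-ABS-CNF to $p_{\alpha,d}$-ABS-DNF.
   Context: A CNF formula is a conjunction of clauses, each a disjunction of literals, and a CNF clause is satisfied if at least one literal is true; a DNF formula is a disjunction of clauses, each a conjunction of literals, and a DNF clause is satisfied if all its literals are true; $\mathrm{clause}(\phi)$ is the set of clauses of $\phi$. Problem $p_{\alpha,d}$-ABS-CNF (resp. $p_{\alpha,d}$-ABS-DNF): given a CNF (resp. DNF) formula $\phi$, a weight function $w\colon\mathrm{clause}(\phi)\to\mathbb{Z}$ (negative weights allowed), and $\alpha\in\mathbb{N}$, decide whether there is an assignment $\beta$ with $\left|\sum_{c\in\mathrm{clause}(\phi),\,\beta\models c}w(c)\right|\ge\alpha$; the parameters are $\alpha$ and $d$, the maximum number of literals in a clause of $\phi$. -}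

module Defs where

open import Data.Nat using (ℕ; zero; suc; _+_; _*_; _^_; _≤_; _⊔_; _≟_)
open import Relation.Nullary using (yes; no)
open import Data.Nat.Binary as B using (ℕᵇ)
open import Data.Integer as ℤ using (ℤ; +_; -[1+_]; ∣_∣)
open import Data.Bool using (Bool; true; false; if_then_else_; _∧_; _∨_; not)
open import Data.List using (List; []; _∷_; _++_; length; foldr; concat; map; lookup)
open import Data.Product using (Σ; _×_; _,_; proj₁)
open import Data.Fin using (Fin; zero; suc; _↑ˡ_; toℕ)
open import Data.Maybe using (Maybe; just; nothing)
open import Relation.Binary.PropositionalEquality using (_≡_)

-- A literal: (variable index, polarity); polarity true = positive literal.
Literal : Set
Literal = ℕ × Bool

Clause : Set
Clause = List Literal

-- The same data type is used for CNF and
-- DNF instances; only the semantics of clause satisfaction differs.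
record Instance : Set where
  constructor inst
  field
    clauses : List (Clause × ℤ)
    α       : ℕ
open Instance public

Assignment : Set
Assignment = ℕ → Bool

litVal : Assignment → Literal → Bool
litVal β (v , true)  = β v
litVal β (v , false) = not (β v)

cnfSat : Assignment → Clause → Bool
cnfSat β c = foldr (λ l b → litVal β l ∨ b) false c

dnfSat : Assignment → Clause → Bool
dnfSat β c = foldr (λ l b → litVal β l ∧ b) true c

weightSum : (Assignment → Clause → Bool) → Assignment → List (Clause × ℤ) → ℤ
weightSum sat β []             = + 0
weightSum sat β ((c , w) ∷ cs) = (if sat β c then w else + 0) ℤ.+ weightSum sat β cs

maxWidth : List (Clause × ℤ) → ℕ
maxWidth = foldr (λ p m → length (proj₁ p) ⊔ m) 0

ABS-CNF : Instance → Set
ABS-CNF x = Σ Assignment λ β → α x ≤ ∣ weightSum cnfSat β (clauses x) ∣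

ABS-DNF : Instance → Set
ABS-DNF x = Σ Assignment λ β → α x ≤ ∣ weightSum dnfSat β (clauses x) ∣

-- The parameter (α, d), combined into a single natural number α + d.
param : Instance → ℕ
param x = α x + maxWidth (clauses x)

Sym : Set
Sym = Fin 7

s0 s1 sP sN sComma sSemi sHash : Sym
s0     = zero
s1     = suc zero
sP     = suc (suc zero)
sN     = suc (suc (suc zero))
sComma = suc (suc (suc (suc zero)))
sSemi  = suc (suc (suc (suc (suc zero))))
sHash  = suc (suc (suc (suc (suc (suc zero)))))

-- bijective binary notation (length Θ(log n))
encB : ℕᵇ → List Sym
encB B.zero      = []
encB (B.2[1+ x ]) = s1 ∷ encB x
encB (B.1+[2 x ]) = s0 ∷ encB x

encℕ : ℕ → List Sym
encℕ n = encB (B.fromℕ n)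

encℤ : ℤ → List Sym
encℤ (+ n)      = sP ∷ encℕ n
encℤ -[1+ n ]   = sN ∷ encℕ (suc n)

encLit : Literal → List Sym
encLit (v , b) = (if b then sP else sN) ∷ (encℕ v ++ (sComma ∷ []))

encClause : Clause × ℤ → List Sym
encClause (c , w) = concat (map encLit c) ++ (encℤ w ++ (sSemi ∷ []))

enc : Instance → List Sym
enc x = encℕ (α x) ++ (sHash ∷ concat (map encClause (clauses x)))

data Move : Set where
  left right stay : Move

-- Tape alphabet Fin (8 + extra): zero is the blank, suc (i ↑ˡ extra)
-- is input symbol i.  States Fin (suc nStates); δ returning nothing = halt.
record TM : Set where
  field
    nStates : ℕ
    extra   : ℕ
    start   : Fin (suc nStates)
    δ       : Fin (suc nStates) → Fin (8 + extra)
              → Maybe (Fin (suc nStates) × Fin (8 + extra) × Move)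
open TM public

module _ (M : TM) where
  Γ : Set
  Γ = Fin (8 + extra M)

  blank : Γ
  blank = zero

  inSym : Sym → Γ
  inSym i = suc (i ↑ˡ extra M)

  record Config : Set where
    constructor cfg
    field
      state : Fin (suc (nStates M))
      head  : ℕ
      tape  : ℕ → Γ
  open Config public

  write : (ℕ → Γ) → ℕ → Γ → ℕ → Γ
  write t h a i with i ≟ h
  ... | yes _ = a
  ... | no _  = t i

  move : Move → ℕ → ℕ
  move left zero    = zero
  move left (suc h) = h
  move right h       = suc h
  move stay h       = h

  step : Config → Maybe Config
  step (cfg q h t) with δ M q (t h)
  ... | nothing             = nothing
  ... | just (q' , a , m)   = just (cfg q' (move m h) (write t h a))

  run : ℕ → Config → Maybe Config
  run n c with step c
  ... | nothing = just c
  ... | just c' with n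
  ...   | zero  = nothing
  ...   | suc k = run k c'

  inputTape : List Sym → ℕ → Γ
  inputTape []       _       = blank
  inputTape (a ∷ w)  zero    = inSym a
  inputTape (a ∷ w)  (suc i) = inputTape w i

  initial : List Sym → Config
  initial w = cfg (start M) 0 (inputTape w)

  Outputs : (ℕ → Γ) → List Sym → Set
  Outputs t w = ((i : Fin (length w)) → t (toℕ i) ≡ inSym (lookup w i))
              × t (length w) ≡ blank

-- fpt-reductions (Flum–Grohe), for problems on Instance with parameter
-- `param`.  f, g are Agda functions, hence computable.

record FPTReduction (L₁ L₂ : Instance → Set) : Set₁ where
  field
    R           : Instance → Instance
    sound       : ∀ x → L₁ x → L₂ (R x)
    complete    : ∀ x → L₂ (R x) → L₁ x
    g           : ℕ → ℕ
    param-bound : ∀ x → param (R x) ≤ g (param x)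
    f           : ℕ → ℕ
    c           : ℕ
    M           : TM
    runs        : ∀ x → Σ (Config M) λ h →
                    (run M (f (param x) * suc (length (enc x)) ^ c) (initial M (enc x)) ≡ just h)
                    × Outputs M (Config.tape h) (enc (R x))

-- Each weighted CNF clause (c , w) becomes two DNF clauses: the conjunction of the negated
-- literals of c with weight w, and the empty conjunction, satisfied by every assignment, with
-- weight -w.  An assignment satisfies the first exactly when it falsifies c, so the weight it
-- satisfies in the DNF instance is (Σ_{β ⊭ c} w) - Σ w = - Σ_{β ⊨ c} w: the absolute value is
-- unchanged, and so are α and the maximal clause width.
--
-- A single-tape machine computes the reduction in quadratic time with two sweeps over the
-- encoding.  Right to left, it flips the polarity of every literal and marks every symbol of a
-- weight with its counterpart in the encoding of the negated weight.  Left to right, it restores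
-- each marked symbol and carries its counterpart to the end of the tape, where the compensating
-- clauses accumulate.

module Submission where

open import Defs
open import Data.Bool using (true; false; if_then_else_; not)
open import Data.Bool.Properties using (not-involutive)
open import Data.Empty using (⊥-elim)
open import Data.Fin using (Fin; zero; suc; _↑ˡ_; _↑ʳ_; toℕ; splitAt; combine; remQuot)
open import Data.Fin.Properties using (splitAt-↑ˡ; splitAt-↑ʳ; remQuot-combine)
open import Data.Integer as ℤ using (ℤ; +_; -[1+_]; ∣_∣)
open import Data.Integer.Properties as ℤₚ using (∣-i∣≡∣i∣; neg-distrib-+)
open import Data.Integer.Tactic.RingSolver using () renaming (solve-∀ to ℤ-solve-∀)
open import Data.List using (List; []; _∷_; _++_; length; concat; map; lookup; _ʳ++_; reverse)
open import Data.List.Properties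
  using (ʳ++-defn; ++-ʳ++; ʳ++-ʳ++; length-ʳ++; length-++; length-map; map-++; ++-assoc; ++-identityʳ;
         reverse-involutive; length-reverse; concat-++)
open import Data.List.Relation.Unary.All using (All; []; _∷_)
open import Data.List.Relation.Unary.All.Properties using (++⁺)
open import Data.Maybe using (Maybe; just; nothing)
open import Data.Nat using (ℕ; zero; suc; _+_; _*_; _^_; _≤_; _⊔_; _≟_; z≤n; s≤s)
open import Data.Nat.Binary as B using ()
open import Data.Nat.Binary.Properties using (fromℕ≡fromℕ')
open import Data.Nat.Properties
  using (+-assoc; +-identityʳ; +-comm; ≤-refl; ≤-reflexive; ≤-trans; +-mono-≤; *-mono-≤; suc-injective;
         n≤1+n; m≤n+m; m≤m+n; ⊔-assoc; ⊔-identityʳ)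
open import Data.Nat.Tactic.RingSolver using (solve-∀)
open import Data.Product using (Σ; _×_; _,_; proj₁; proj₂)
open import Data.Sum using ([_,_]′)
open import Relation.Nullary using (yes; no; ¬_)
open import Relation.Binary.PropositionalEquality
  using (_≡_; refl; sym; trans; cong; cong₂; subst; module ≡-Reasoning)

-- The reduction

negate : Literal → Literal
negate (v , b) = v , not b

negatedClause : Clause × ℤ → Clause × ℤ
negatedClause (c , w) = map negate c , w

compensatingClause : Clause × ℤ → Clause × ℤ
compensatingClause (c , w) = [] , ℤ.- w

cnf⇒dnf : Instance → Instance
cnf⇒dnf x = inst (map negatedClause (clauses x) ++ map compensatingClause (clauses x)) (α x)

weightSum-++ : ∀ sat β (cs ds : List (Clause × ℤ)) →
  weightSum sat β (cs ++ ds) ≡ weightSum sat β cs ℤ.+ weightSum sat β ds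
weightSum-++ sat β []             ds = sym (ℤₚ.+-identityˡ _)
weightSum-++ sat β ((c , w) ∷ cs) ds = begin
  a ℤ.+ weightSum sat β (cs ++ ds)                        ≡⟨ cong (λ s → a ℤ.+ s) (weightSum-++ sat β cs ds) ⟩
  a ℤ.+ (weightSum sat β cs ℤ.+ weightSum sat β ds)       ≡⟨ ℤₚ.+-assoc a _ _ ⟨
  a ℤ.+ weightSum sat β cs ℤ.+ weightSum sat β ds         ∎
  where
  open ≡-Reasoning
  a : ℤ
  a = if sat β c then w else + 0

litVal-negate : ∀ β l → litVal β (negate l) ≡ not (litVal β l)
litVal-negate β (v , true)  = refl
litVal-negate β (v , false) = sym (not-involutive (β v))

dnfSat-negate : ∀ β c → dnfSat β (map negate c) ≡ not (cnfSat β c)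
dnfSat-negate β []      = refl
dnfSat-negate β (l ∷ c) rewrite litVal-negate β l | dnfSat-negate β c with litVal β l
... | true  = refl
... | false = refl

negated+compensating : ∀ β c w →
  (if dnfSat β (map negate c) then w else + 0) ℤ.+ ℤ.- w ≡ ℤ.- (if cnfSat β c then w else + 0)
negated+compensating β c w rewrite dnfSat-negate β c with cnfSat β c
... | true  = ℤₚ.+-identityˡ (ℤ.- w)
... | false = ℤₚ.+-inverseʳ w

weightSum-cnf⇒dnf : ∀ β cs →
  weightSum dnfSat β (map negatedClause cs ++ map compensatingClause cs) ≡ ℤ.- weightSum cnfSat β cs
weightSum-cnf⇒dnf β []             = refl
weightSum-cnf⇒dnf β ((c , w) ∷ cs) = begin
  weightSum dnfSat β (map negatedClause ((c , w) ∷ cs) ++ map compensatingClause ((c , w) ∷ cs))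
    ≡⟨ weightSum-++ dnfSat β (map negatedClause ((c , w) ∷ cs)) _ ⟩
  (a ℤ.+ N) ℤ.+ (ℤ.- w ℤ.+ C)
    ≡⟨ interchange a (ℤ.- w) N C ⟩
  (a ℤ.+ ℤ.- w) ℤ.+ (N ℤ.+ C)
    ≡⟨ cong₂ ℤ._+_ (negated+compensating β c w)
                   (trans (sym (weightSum-++ dnfSat β (map negatedClause cs) _)) (weightSum-cnf⇒dnf β cs)) ⟩
  ℤ.- (if cnfSat β c then w else + 0) ℤ.+ ℤ.- weightSum cnfSat β cs
    ≡⟨ neg-distrib-+ (if cnfSat β c then w else + 0) (weightSum cnfSat β cs) ⟨
  ℤ.- weightSum cnfSat β ((c , w) ∷ cs) ∎
  where
  open ≡-Reasoning
  a N C : ℤ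
  a = if dnfSat β (map negate c) then w else + 0
  N = weightSum dnfSat β (map negatedClause cs)
  C = weightSum dnfSat β (map compensatingClause cs)
  interchange : ∀ a b c d → (a ℤ.+ c) ℤ.+ (b ℤ.+ d) ≡ (a ℤ.+ b) ℤ.+ (c ℤ.+ d)
  interchange = ℤ-solve-∀

∣weightSum∣-cnf⇒dnf : ∀ β x →
  ∣ weightSum dnfSat β (clauses (cnf⇒dnf x)) ∣ ≡ ∣ weightSum cnfSat β (clauses x) ∣
∣weightSum∣-cnf⇒dnf β x =
  trans (cong ∣_∣ (weightSum-cnf⇒dnf β (clauses x))) (∣-i∣≡∣i∣ (weightSum cnfSat β (clauses x)))

cnf⇒dnf-sound : ∀ x → ABS-CNF x → ABS-DNF (cnf⇒dnf x)
cnf⇒dnf-sound x (β , α≤) = β , subst (α x ≤_) (sym (∣weightSum∣-cnf⇒dnf β x)) α≤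

cnf⇒dnf-complete : ∀ x → ABS-DNF (cnf⇒dnf x) → ABS-CNF x
cnf⇒dnf-complete x (β , α≤) = β , subst (α x ≤_) (∣weightSum∣-cnf⇒dnf β x) α≤

maxWidth-++ : ∀ cs ds → maxWidth (cs ++ ds) ≡ maxWidth cs ⊔ maxWidth ds
maxWidth-++ []             ds = refl
maxWidth-++ ((c , w) ∷ cs) ds rewrite maxWidth-++ cs ds =
  sym (⊔-assoc (length c) (maxWidth cs) (maxWidth ds))

maxWidth-negated : ∀ cs → maxWidth (map negatedClause cs) ≡ maxWidth cs
maxWidth-negated []             = refl
maxWidth-negated ((c , w) ∷ cs) = cong₂ _⊔_ (length-map negate c) (maxWidth-negated cs)

maxWidth-compensating : ∀ cs → maxWidth (map compensatingClause cs) ≡ 0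
maxWidth-compensating []       = refl
maxWidth-compensating (_ ∷ cs) = maxWidth-compensating cs

param-cnf⇒dnf : ∀ x → param (cnf⇒dnf x) ≡ param x
param-cnf⇒dnf x = cong (λ d → α x + d) (begin
  maxWidth (map negatedClause cs ++ map compensatingClause cs)
    ≡⟨ maxWidth-++ (map negatedClause cs) _ ⟩
  maxWidth (map negatedClause cs) ⊔ maxWidth (map compensatingClause cs)
    ≡⟨ cong₂ _⊔_ (maxWidth-negated cs) (maxWidth-compensating cs) ⟩
  maxWidth cs ⊔ 0
    ≡⟨ ⊔-identityʳ _ ⟩
  maxWidth cs ∎)
  where
  open ≡-Reasoning
  cs : List (Clause × ℤ)
  cs = clauses x

-- The machine

-- marked o v is a symbol o of the encoding of a weight w, whose counterpart in the encoding of
-- -w is v and still has to be appended; pending o is such a symbol while v is being appended.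
data TapeSym : Set where
  □       : TapeSym
  input   : Sym → TapeSym
  marked  : Sym → Sym → TapeSym
  pending : Sym → TapeSym

Cell : Set
Cell = Fin (8 + 56)

encodeSym : TapeSym → Cell
encodeSym □            = zero
encodeSym (input s)    = suc (s ↑ˡ 56)
encodeSym (marked o v) = suc (7 ↑ʳ (combine o v ↑ˡ 7))
encodeSym (pending o)  = suc (7 ↑ʳ (49 ↑ʳ o))

decodeSym : Cell → TapeSym
decodeSym zero    = □
decodeSym (suc k) = [ input , decodeExtra ]′ (splitAt 7 k)
  where
  decodeExtra : Fin (49 + 7) → TapeSym
  decodeExtra j =
    [ (λ p → marked (proj₁ (remQuot {7} 7 p)) (proj₂ (remQuot {7} 7 p))) , pending ]′ (splitAt 49 j)

decodeSym-encodeSym : ∀ s → decodeSym (encodeSym s) ≡ s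
decodeSym-encodeSym □ = refl
decodeSym-encodeSym (input s) rewrite splitAt-↑ˡ 7 s 56 = refl
decodeSym-encodeSym (marked o v)
  rewrite splitAt-↑ʳ 7 56 (combine o v ↑ˡ 7) | splitAt-↑ˡ 49 (combine o v) 7
  = cong (λ p → marked (proj₁ p) (proj₂ p)) (remQuot-combine {7} {7} o v)
decodeSym-encodeSym (pending o) rewrite splitAt-↑ʳ 7 56 (49 ↑ʳ o) | splitAt-↑ʳ 49 7 o = refl

data State : Set where
  seekEnd sweep literal weight₀ weight₁ copy back : State
  carry : Sym → State

encodeState : State → Fin 14
encodeState seekEnd   = zero
encodeState sweep     = suc zero
encodeState literal   = suc (suc zero)
encodeState weight₀   = suc (suc (suc zero))
encodeState weight₁   = suc (suc (suc (suc zero)))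
encodeState copy      = suc (suc (suc (suc (suc zero))))
encodeState back      = suc (suc (suc (suc (suc (suc zero)))))
encodeState (carry v) = suc (suc (suc (suc (suc (suc (suc v))))))

decodeState : Fin 14 → State
decodeState zero                                          = seekEnd
decodeState (suc zero)                                    = sweep
decodeState (suc (suc zero))                              = literal
decodeState (suc (suc (suc zero)))                        = weight₀
decodeState (suc (suc (suc (suc zero))))                  = weight₁
decodeState (suc (suc (suc (suc (suc zero)))))            = copy
decodeState (suc (suc (suc (suc (suc (suc zero))))))      = back
decodeState (suc (suc (suc (suc (suc (suc (suc v))))))) = carry v

decodeState-encodeState : ∀ q → decodeState (encodeState q) ≡ q
decodeState-encodeState seekEnd   = refl
decodeState-encodeState sweep     = refl
decodeState-encodeState literal   = refl
decodeState-encodeState weight₀   = refl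
decodeState-encodeState weight₁   = refl
decodeState-encodeState copy      = refl
decodeState-encodeState back      = refl
decodeState-encodeState (carry v) = refl

pattern zeroˢ  = zero
pattern oneˢ   = suc zero
pattern plusˢ  = suc (suc zero)
pattern minusˢ = suc (suc (suc zero))
pattern commaˢ = suc (suc (suc (suc zero)))
pattern semiˢ  = suc (suc (suc (suc (suc zero))))
pattern hashˢ  = suc (suc (suc (suc (suc (suc zero)))))

transition : State → TapeSym → Maybe (State × TapeSym × Move)
transition seekEnd □                = just (sweep , □ , left)
transition seekEnd s                = just (seekEnd , s , right)
transition sweep (input semiˢ)      = just (weight₀ , marked semiˢ semiˢ , left)
transition sweep (input commaˢ)     = just (literal , input commaˢ , left)
transition sweep (input hashˢ)      = just (copy , input hashˢ , right)
transition literal (input zeroˢ)    = just (literal , input zeroˢ , left)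
transition literal (input oneˢ)     = just (literal , input oneˢ , left)
transition literal (input plusˢ)    = just (sweep , input minusˢ , left)
transition literal (input minusˢ)   = just (sweep , input plusˢ , left)
-- -w has the digits of w and the opposite sign, except that +0 keeps its sign;
-- weight₀ means that no digit has been read yet.
transition weight₀ (input zeroˢ)    = just (weight₁ , marked zeroˢ zeroˢ , left)
transition weight₀ (input oneˢ)     = just (weight₁ , marked oneˢ oneˢ , left)
transition weight₀ (input plusˢ)    = just (sweep , marked plusˢ plusˢ , left)
transition weight₁ (input zeroˢ)    = just (weight₁ , marked zeroˢ zeroˢ , left)
transition weight₁ (input oneˢ)     = just (weight₁ , marked oneˢ oneˢ , left)
transition weight₁ (input plusˢ)    = just (sweep , marked plusˢ minusˢ , left)
transition weight₁ (input minusˢ)   = just (sweep , marked minusˢ plusˢ , left)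
transition copy (input s)           = just (copy , input s , right)
transition copy (marked o v)        = just (carry v , pending o , right)
transition (carry v) □              = just (back , input v , left)
transition (carry v) s              = just (carry v , s , right)
transition back (pending o)         = just (copy , input o , right)
transition back s                   = just (back , s , left)
transition _ _                      = nothing

encodeAction : Maybe (State × TapeSym × Move) → Maybe (Fin 14 × Cell × Move)
encodeAction nothing              = nothing
encodeAction (just (q , s , m))   = just (encodeState q , encodeSym s , m)

machine : TM
machine = record
  { nStates = 13
  ; extra   = 56
  ; start   = encodeState seekEnd
  ; δ       = λ q a → encodeAction (transition (decodeState q) (decodeSym a))
  }

δ-encode : ∀ q s → δ machine (encodeState q) (encodeSym s) ≡ encodeAction (transition q s)
δ-encode q s rewrite decodeState-encodeState q | decodeSym-encodeSym s = refl

Tape : Set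
Tape = ℕ → Cell

cell : List TapeSym → ℕ → TapeSym
cell []      _       = □
cell (a ∷ L) zero    = a
cell (a ∷ L) (suc i) = cell L i

Represents : Tape → List TapeSym → Set
Represents t L = ∀ i → t i ≡ encodeSym (cell L i)

cell-++-length : ∀ L s R → cell (L ++ s ∷ R) (length L) ≡ s
cell-++-length []      s R = refl
cell-++-length (a ∷ L) s R = cell-++-length L s R

cell-++-≢ : ∀ L s s' R i → ¬ (i ≡ length L) → cell (L ++ s ∷ R) i ≡ cell (L ++ s' ∷ R) i
cell-++-≢ []      s s' R zero    i≢ = ⊥-elim (i≢ refl)
cell-++-≢ []      s s' R (suc i) i≢ = refl
cell-++-≢ (a ∷ L) s s' R zero    i≢ = refl
cell-++-≢ (a ∷ L) s s' R (suc i) i≢ = cell-++-≢ L s s' R i (λ i≡ → i≢ (cong suc i≡))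

cell-∷ʳ-□ : ∀ L i → cell (L ++ □ ∷ []) i ≡ cell L i
cell-∷ʳ-□ []      zero    = refl
cell-∷ʳ-□ []      (suc i) = refl
cell-∷ʳ-□ (a ∷ L) zero    = refl
cell-∷ʳ-□ (a ∷ L) (suc i) = cell-∷ʳ-□ L i

-- A tape Lr ʳ++ (s ∷ R) is read with the head on s, at position length Lr.
cell-ʳ++-length : ∀ Lr s R → cell (Lr ʳ++ (s ∷ R)) (length Lr) ≡ s
cell-ʳ++-length Lr s R rewrite ʳ++-defn Lr {s ∷ R} | sym (length-reverse Lr) = cell-++-length (reverse Lr) s R

cell-ʳ++-≢ : ∀ Lr s s' R i → ¬ (i ≡ length Lr) → cell (Lr ʳ++ (s ∷ R)) i ≡ cell (Lr ʳ++ (s' ∷ R)) i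
cell-ʳ++-≢ Lr s s' R i i≢ rewrite ʳ++-defn Lr {s ∷ R} | ʳ++-defn Lr {s' ∷ R} =
  cell-++-≢ (reverse Lr) s s' R i (λ i≡ → i≢ (trans i≡ (length-reverse Lr)))

cell-ʳ++-∷ʳ-□ : ∀ Lr R i → cell (Lr ʳ++ (R ++ □ ∷ [])) i ≡ cell (Lr ʳ++ R) i
cell-ʳ++-∷ʳ-□ Lr R i rewrite ʳ++-defn Lr {R ++ □ ∷ []} | ʳ++-defn Lr {R} | sym (++-assoc (reverse Lr) R (□ ∷ [])) =
  cell-∷ʳ-□ (reverse Lr ++ R) i

Represents-write : ∀ t Lr s s' R → Represents t (Lr ʳ++ (s ∷ R)) →
  Represents (write machine t (length Lr) (encodeSym s')) (Lr ʳ++ (s' ∷ R))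
Represents-write t Lr s s' R rep i with i ≟ length Lr
... | yes refl = cong encodeSym (sym (cell-ʳ++-length Lr s' R))
... | no i≢    = trans (rep i) (cong encodeSym (cell-ʳ++-≢ Lr s s' R i i≢))

data Steps : ℕ → Config machine → Config machine → Set where
  done : ∀ {c} → Steps 0 c c
  more : ∀ {k c c' c''} → step machine c ≡ just c' → Steps k c' c'' → Steps (suc k) c c''

Steps-++ : ∀ {k₁ k₂ c₁ c₂ c₃} → Steps k₁ c₁ c₂ → Steps k₂ c₂ c₃ → Steps (k₁ + k₂) c₁ c₃
Steps-++ done         s₂ = s₂
Steps-++ (more e s₁)  s₂ = more e (Steps-++ s₁ s₂)

record Run (q : State) (h : ℕ) (L : List TapeSym) (q' : State) (h' : ℕ) (L' : List TapeSym) (B : ℕ) : Set where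
  constructor mkRun
  field
    simulate : ∀ t → Represents t L → Σ ℕ λ k → Σ Tape λ t' →
      Steps k (cfg (encodeState q) h t) (cfg (encodeState q') h' t') × Represents t' L' × k ≤ B
open Run

Run-refl : ∀ {q h L B} → Run q h L q h L B
Run-refl = mkRun λ t rep → 0 , t , done , rep , z≤n

Run-trans : ∀ {q h L q₁ h₁ L₁ q₂ h₂ L₂ B₁ B₂} →
  Run q h L q₁ h₁ L₁ B₁ → Run q₁ h₁ L₁ q₂ h₂ L₂ B₂ → Run q h L q₂ h₂ L₂ (B₁ + B₂)
Run-trans r₁ r₂ = mkRun λ t rep →
  let (k₁ , t₁ , s₁ , rep₁ , b₁) = simulate r₁ t rep
      (k₂ , t₂ , s₂ , rep₂ , b₂) = simulate r₂ t₁ rep₁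
  in k₁ + k₂ , t₂ , Steps-++ s₁ s₂ , rep₂ , +-mono-≤ b₁ b₂

Run-mono : ∀ {q h L q' h' L' B B'} → B ≤ B' → Run q h L q' h' L' B → Run q h L q' h' L' B'
Run-mono B≤B' r = mkRun λ t rep →
  let (k , t' , s , rep' , b) = simulate r t rep in k , t' , s , rep' , ≤-trans b B≤B'

Run-subst : ∀ {q h₁ h₂ L₁ L₂ q' h₁' h₂' L₁' L₂' B} → h₁ ≡ h₂ → L₁ ≡ L₂ → h₁' ≡ h₂' → L₁' ≡ L₂' →
  Run q h₁ L₁ q' h₁' L₁' B → Run q h₂ L₂ q' h₂' L₂' B
Run-subst refl refl refl refl r = r

Run-cong-end : ∀ {q h L q' h' L' L'' B} → (∀ i → cell L' i ≡ cell L'' i) →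
  Run q h L q' h' L' B → Run q h L q' h' L'' B
Run-cong-end L'≗L'' r = mkRun λ t rep →
  let (k , t' , s , rep' , b) = simulate r t rep
  in k , t' , s , (λ i → trans (rep' i) (cong encodeSym (L'≗L'' i))) , b

step-transition : ∀ {q h t q' a m} → δ machine q (t h) ≡ just (q' , a , m) →
  step machine (cfg q h t) ≡ just (cfg q' (move machine m h) (write machine t h a))
step-transition {q} {h} {t} eq with δ machine q (t h)
step-transition refl | just _ = refl

step-halt : ∀ {q h t} → δ machine q (t h) ≡ nothing → step machine (cfg q h t) ≡ nothing
step-halt {q} {h} {t} eq with δ machine q (t h)
step-halt refl | nothing = refl

step-represented : ∀ {q s q' s' m} t Lr R → Represents t (Lr ʳ++ (s ∷ R)) → transition q s ≡ just (q' , s' , m) →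
  step machine (cfg (encodeState q) (length Lr) t)
    ≡ just (cfg (encodeState q') (move machine m (length Lr)) (write machine t (length Lr) (encodeSym s')))
step-represented {q} {s} {q'} {s'} {m} t Lr R rep eq = step-transition (begin
  δ machine (encodeState q) (t (length Lr))
    ≡⟨ cong (δ machine (encodeState q)) (trans (rep (length Lr)) (cong encodeSym (cell-ʳ++-length Lr s R))) ⟩
  δ machine (encodeState q) (encodeSym s)
    ≡⟨ δ-encode q s ⟩
  encodeAction (transition q s)
    ≡⟨ cong encodeAction eq ⟩
  just (encodeState q' , encodeSym s' , m) ∎)
  where open ≡-Reasoning

stepRight : ∀ {q s q' s'} Lr R → transition q s ≡ just (q' , s' , right) →
  Run q (length Lr) (Lr ʳ++ (s ∷ R)) q' (suc (length Lr)) (Lr ʳ++ (s' ∷ R)) 1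
stepRight {s = s} {s' = s'} Lr R eq = mkRun λ t rep →
  1 , _ , more (step-represented t Lr R rep eq) done , Represents-write t Lr s s' R rep , ≤-refl

stepLeft : ∀ {q s q' s'} a Lr R → transition q s ≡ just (q' , s' , left) →
  Run q (length (a ∷ Lr)) (Lr ʳ++ (a ∷ s ∷ R)) q' (length Lr) (Lr ʳ++ (a ∷ s' ∷ R)) 1
stepLeft {s = s} {s' = s'} a Lr R eq = mkRun λ t rep →
  1 , _ , more (step-represented t (a ∷ Lr) R rep eq) done , Represents-write t (a ∷ Lr) s s' R rep , ≤-refl

scanRight : ∀ {q} (P : TapeSym → Set) → (∀ {s} → P s → transition q s ≡ just (q , s , right)) →
  ∀ Lr X → All P X → Run q (length Lr) (Lr ʳ++ X) q (length (Lr ʳ++ X)) (Lr ʳ++ X) (length X)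
scanRight P skip Lr []      []         =
  Run-subst refl refl (sym (trans (length-ʳ++ Lr) (+-identityʳ (length Lr)))) refl Run-refl
scanRight P skip Lr (x ∷ X) (px ∷ pX) =
  Run-trans (stepRight Lr X (skip px)) (scanRight P skip (x ∷ Lr) X pX)

scanLeft : ∀ {q s q' s'} (P : TapeSym → Set) → (∀ {y} → P y → transition q' y ≡ just (q' , y , left)) →
  transition q s ≡ just (q' , s' , left) → ∀ Y → All P Y → ∀ z Lr R →
  Run q (length (Y ++ z ∷ Lr)) ((Y ++ z ∷ Lr) ʳ++ (s ∷ R)) q' (length Lr) (Lr ʳ++ (z ∷ (Y ʳ++ (s' ∷ R)))) (suc (length Y))
scanLeft P skip eq []      []         z Lr R = stepLeft z Lr R eq
scanLeft {s' = s'} P skip eq (y ∷ Y) (py ∷ pY) z Lr R =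
  Run-trans (stepLeft y (Y ++ z ∷ Lr) R eq) (scanLeft P skip (skip py) Y pY z Lr (s' ∷ R))

-- The first sweep

-- The head moves left from the last cell of X to the last cell of Lp, rewriting X into X'.
record LeftSweep (q : State) (X : List TapeSym) (q' : State) (X' : List TapeSym) : Set where
  constructor mkLeftSweep
  field
    sweepRun : ∀ Lp S h → suc h ≡ length Lp →
      Run q (h + length X) (Lp ʳ++ (X ++ S)) q' h (Lp ʳ++ (X' ++ S)) (length X)
open LeftSweep

LeftSweep-subst : ∀ {q X₁ X₂ q' Y₁ Y₂} → X₁ ≡ X₂ → Y₁ ≡ Y₂ → LeftSweep q X₁ q' Y₁ → LeftSweep q X₂ q' Y₂
LeftSweep-subst refl refl sw = sw

LeftSweep-[] : ∀ {q} → LeftSweep q [] q []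
LeftSweep-[] = mkLeftSweep λ Lp S h _ → Run-subst (sym (+-identityʳ h)) refl refl refl Run-refl

LeftSweep-step : ∀ {q x q' x'} → transition q x ≡ just (q' , x' , left) → LeftSweep q (x ∷ []) q' (x' ∷ [])
LeftSweep-step {q} {x} {q'} {x'} eq = mkLeftSweep run₁
  where
  run₁ : ∀ Lp S h → suc h ≡ length Lp → Run q (h + 1) (Lp ʳ++ (x ∷ S)) q' h (Lp ʳ++ (x' ∷ S)) 1
  run₁ []       S h ()
  run₁ (a ∷ Lr) S h e with suc-injective e
  ... | refl = Run-subst (+-comm 1 (length Lr)) refl refl refl (stepLeft a Lr S eq)

LeftSweep-++ : ∀ {q X₁ X₂ q₁ q₂ X₁' X₂'} → LeftSweep q X₂ q₁ X₂' → LeftSweep q₁ X₁ q₂ X₁' →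
  LeftSweep q (X₁ ++ X₂) q₂ (X₁' ++ X₂')
LeftSweep-++ {X₁ = X₁} {X₂} {X₁' = X₁'} {X₂'} sw₂ sw₁ = mkLeftSweep λ Lp S h e →
  Run-subst (initialHead h) (trans (ʳ++-ʳ++ X₁) (cong (Lp ʳ++_) (sym (++-assoc X₁ X₂ S)))) refl
            (cong (Lp ʳ++_) (sym (++-assoc X₁' X₂' S)))
    (Run-mono (≤-reflexive steps)
      (Run-trans (Run-subst refl refl refl (ʳ++-ʳ++ X₁)
                   (sweepRun sw₂ (X₁ ʳ++ Lp) S (h + length X₁) (middle Lp h e)))
                 (sweepRun sw₁ Lp (X₂' ++ S) h e)))
  where
  middle : ∀ Lp h → suc h ≡ length Lp → suc (h + length X₁) ≡ length (X₁ ʳ++ Lp)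
  middle Lp h e = trans (cong (_+ length X₁) e) (trans (+-comm (length Lp) (length X₁)) (sym (length-ʳ++ X₁)))
  initialHead : ∀ h → h + length X₁ + length X₂ ≡ h + length (X₁ ++ X₂)
  initialHead h = trans (+-assoc h (length X₁) (length X₂)) (cong (λ m → h + m) (sym (length-++ X₁)))
  steps : length X₂ + length X₁ ≡ length (X₁ ++ X₂)
  steps = trans (+-comm (length X₂) (length X₁)) (sym (length-++ X₁))

data Digit : Sym → Set where
  digit0 : Digit zeroˢ
  digit1 : Digit oneˢ

encB-digits : ∀ b → All Digit (encB b)
encB-digits B.zero      = []
encB-digits B.2[1+ b ]  = digit1 ∷ encB-digits b
encB-digits B.1+[2 b ]  = digit0 ∷ encB-digits b

encℕ-digits : ∀ n → All Digit (encℕ n)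
encℕ-digits n = encB-digits (B.fromℕ n)

encB-suc-nonempty : ∀ b → Σ Sym λ d → Σ (List Sym) λ ds → encB (B.suc b) ≡ d ∷ ds
encB-suc-nonempty B.zero     = _ , _ , refl
encB-suc-nonempty B.2[1+ b ] = _ , _ , refl
encB-suc-nonempty B.1+[2 b ] = _ , _ , refl

encℕ-suc-nonempty : ∀ n → Σ Sym λ d → Σ (List Sym) λ ds → encℕ (suc n) ≡ d ∷ ds
encℕ-suc-nonempty n rewrite fromℕ≡fromℕ' (suc n) = encB-suc-nonempty (B.fromℕ' n)

encLits : Clause → List Sym
encLits c = concat (map encLit c)

doubled : Sym → TapeSym
doubled d = marked d d

signOfNegated : ℕ → Sym
signOfNegated zero    = plusˢ
signOfNegated (suc _) = minusˢ

markedWeight : ℤ → List TapeSym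
markedWeight (+ n)    = marked plusˢ (signOfNegated n) ∷ (map doubled (encℕ n) ++ doubled semiˢ ∷ [])
markedWeight -[1+ n ] = marked minusˢ plusˢ ∷ (map doubled (encℕ (suc n)) ++ doubled semiˢ ∷ [])

swept : Clause × ℤ → List TapeSym
swept (c , w) = map input (encLits (map negate c)) ++ markedWeight w

transition-literal-digit : ∀ {d} → Digit d → transition literal (input d) ≡ just (literal , input d , left)
transition-literal-digit digit0 = refl
transition-literal-digit digit1 = refl

sweep-variableDigits : ∀ ds → All Digit ds → LeftSweep literal (map input ds) literal (map input ds)
sweep-variableDigits []       []         = LeftSweep-[]
sweep-variableDigits (d ∷ ds) (pd ∷ pds) =
  LeftSweep-++ {X₁ = input d ∷ []} (sweep-variableDigits ds pds) (LeftSweep-step (transition-literal-digit pd))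

sweep-variable : ∀ v → LeftSweep sweep (map input (encℕ v ++ commaˢ ∷ [])) literal (map input (encℕ v ++ commaˢ ∷ []))
sweep-variable v = LeftSweep-subst (sym (map-++ input (encℕ v) (commaˢ ∷ []))) (sym (map-++ input (encℕ v) (commaˢ ∷ [])))
  (LeftSweep-++ {X₁ = map input (encℕ v)} (LeftSweep-step refl) (sweep-variableDigits (encℕ v) (encℕ-digits v)))

sweep-literal : ∀ l → LeftSweep sweep (map input (encLit l)) sweep (map input (encLit (negate l)))
sweep-literal (v , true)  = LeftSweep-++ {X₁ = input plusˢ ∷ []} (sweep-variable v) (LeftSweep-step refl)
sweep-literal (v , false) = LeftSweep-++ {X₁ = input minusˢ ∷ []} (sweep-variable v) (LeftSweep-step refl)

sweep-literals : ∀ c → LeftSweep sweep (map input (encLits c)) sweep (map input (encLits (map negate c)))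
sweep-literals []      = LeftSweep-[]
sweep-literals (l ∷ c) =
  LeftSweep-subst (sym (map-++ input (encLit l) (encLits c))) (sym (map-++ input (encLit (negate l)) (encLits (map negate c))))
    (LeftSweep-++ (sweep-literals c) (sweep-literal l))

data WeightState : State → Set where
  isWeight₀ : WeightState weight₀
  isWeight₁ : WeightState weight₁

afterDigits : State → List Sym → State
afterDigits q []      = q
afterDigits q (_ ∷ _) = weight₁

afterDigits-weightState : ∀ {q} → WeightState q → ∀ ds → WeightState (afterDigits q ds)
afterDigits-weightState wq []      = wq
afterDigits-weightState wq (_ ∷ _) = isWeight₁

transition-weight-digit : ∀ {q d} → WeightState q → Digit d → transition q (input d) ≡ just (weight₁ , doubled d , left)
transition-weight-digit isWeight₀ digit0 = refl
transition-weight-digit isWeight₀ digit1 = refl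
transition-weight-digit isWeight₁ digit0 = refl
transition-weight-digit isWeight₁ digit1 = refl

sweep-weightDigits : ∀ {q} → WeightState q → ∀ ds → All Digit ds →
  LeftSweep q (map input ds) (afterDigits q ds) (map doubled ds)
sweep-weightDigits wq []       []         = LeftSweep-[]
sweep-weightDigits wq (d ∷ ds) (pd ∷ pds) =
  LeftSweep-++ {X₁ = input d ∷ []} (sweep-weightDigits wq ds pds)
    (LeftSweep-step (transition-weight-digit (afterDigits-weightState wq ds) pd))

sweep-magnitude : ∀ ds → All Digit ds →
  LeftSweep sweep (map input (ds ++ semiˢ ∷ [])) (afterDigits weight₀ ds) (map doubled ds ++ doubled semiˢ ∷ [])
sweep-magnitude ds pds = LeftSweep-subst (sym (map-++ input ds (semiˢ ∷ []))) refl
  (LeftSweep-++ {X₁ = map input ds} (LeftSweep-step refl) (sweep-weightDigits isWeight₀ ds pds))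

sweep-weight : ∀ w → LeftSweep sweep (map input (encℤ w ++ semiˢ ∷ [])) sweep (markedWeight w)
sweep-weight (+ zero) =
  LeftSweep-++ {X₁ = input plusˢ ∷ []} (sweep-magnitude (encℕ 0) (encℕ-digits 0)) (LeftSweep-step refl)
sweep-weight (+ suc n) with encℕ (suc n) | encℕ-digits (suc n) | encℕ-suc-nonempty n
... | _ | pds | d , ds , refl =
  LeftSweep-++ {X₁ = input plusˢ ∷ []} (sweep-magnitude (d ∷ ds) pds) (LeftSweep-step refl)
sweep-weight -[1+ n ] with encℕ (suc n) | encℕ-digits (suc n) | encℕ-suc-nonempty n
... | _ | pds | d , ds , refl =
  LeftSweep-++ {X₁ = input minusˢ ∷ []} (sweep-magnitude (d ∷ ds) pds) (LeftSweep-step refl)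

sweep-clause : ∀ p → LeftSweep sweep (map input (encClause p)) sweep (swept p)
sweep-clause (c , w) = LeftSweep-subst (sym (map-++ input (encLits c) (encℤ w ++ semiˢ ∷ []))) refl
  (LeftSweep-++ (sweep-weight w) (sweep-literals c))

sweep-clauses : ∀ cs → LeftSweep sweep (map input (concat (map encClause cs))) sweep (concat (map swept cs))
sweep-clauses []       = LeftSweep-[]
sweep-clauses (p ∷ cs) = LeftSweep-subst (sym (map-++ input (encClause p) (concat (map encClause cs)))) refl
  (LeftSweep-++ (sweep-clauses cs) (sweep-clause p))

-- The second sweep

data Ordinary : TapeSym → Set where
  ordinaryInput  : ∀ {s} → Ordinary (input s)
  ordinaryMarked : ∀ {o v} → Ordinary (marked o v)

carry-skips : ∀ {v s} → Ordinary s → transition (carry v) s ≡ just (carry v , s , right)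
carry-skips ordinaryInput  = refl
carry-skips ordinaryMarked = refl

back-skips : ∀ {s} → Ordinary s → transition back s ≡ just (back , s , left)
back-skips ordinaryInput  = refl
back-skips ordinaryMarked = refl

All-ʳ++ : ∀ {P : TapeSym → Set} {X Y} → All P X → All P Y → All P (X ʳ++ Y)
All-ʳ++ []         pY = pY
All-ʳ++ (px ∷ pX) pY = All-ʳ++ pX (px ∷ pY)

restore : TapeSym → TapeSym
restore (marked o v) = input o
restore s            = s

copyOf : TapeSym → List TapeSym
copyOf (marked o v) = input v ∷ []
copyOf s            = []

copies : List TapeSym → List TapeSym
copies []      = []
copies (y ∷ Y) = copyOf y ++ copies Y

copyOf-ordinary : ∀ y → All Ordinary (copyOf y)
copyOf-ordinary □            = []
copyOf-ordinary (input s)    = []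
copyOf-ordinary (marked o v) = ordinaryInput ∷ []
copyOf-ordinary (pending o)  = []

length-copyOf : ∀ y → length (copyOf y) ≤ 1
length-copyOf □            = z≤n
length-copyOf (input s)    = z≤n
length-copyOf (marked o v) = s≤s z≤n
length-copyOf (pending o)  = z≤n

length-copies : ∀ Y → length (copies Y) ≤ length Y
length-copies []      = z≤n
length-copies (y ∷ Y) =
  subst (_≤ suc (length Y)) (sym (length-++ (copyOf y))) (+-mono-≤ (length-copyOf y) (length-copies Y))

-- A marked cell costs a trip over the remaining tape W to its end and back.
copyStep : ∀ {y} → Ordinary y → ∀ K Lr W → All Ordinary W → length W ≤ K →
  Run copy (length Lr) (Lr ʳ++ (y ∷ W)) copy (suc (length Lr)) (Lr ʳ++ (restore y ∷ (W ++ copyOf y))) (2 * K + 3)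
copyStep (ordinaryInput {s}) K Lr W _ _ =
  Run-mono (≤-trans (s≤s z≤n) (m≤n+m 3 (2 * K)))
    (Run-subst refl refl refl (cong (λ X → Lr ʳ++ (input s ∷ X)) (sym (++-identityʳ W))) (stepRight Lr W refl))
copyStep (ordinaryMarked {o} {v}) K Lr W ordW W≤K =
  Run-mono (steps≤ (length W) W≤K) (Run-trans (Run-trans (Run-trans mark toEnd) append) unmark)
  where
  steps≤ : ∀ w → w ≤ K → 1 + w + suc w + 1 ≤ 2 * K + 3
  steps≤ w w≤K = subst (_≤ 2 * K + 3) (shuffle w) (+-mono-≤ (+-mono-≤ w≤K (+-mono-≤ w≤K z≤n)) (≤-refl {3}))
    where
    shuffle : ∀ w → w + (w + 0) + 3 ≡ 1 + w + suc w + 1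
    shuffle = solve-∀
  end : List TapeSym
  end = reverse W ++ pending o ∷ Lr
  reverse-ʳ++ : ∀ ys → reverse W ʳ++ ys ≡ W ++ ys
  reverse-ʳ++ ys = trans (ʳ++-defn (reverse W)) (cong (_++ ys) (reverse-involutive W))
  mark : Run copy (length Lr) (Lr ʳ++ (marked o v ∷ W)) (carry v) (suc (length Lr)) (Lr ʳ++ (pending o ∷ W)) 1
  mark = stepRight Lr W refl
  length-end : length ((pending o ∷ Lr) ʳ++ W) ≡ length end
  length-end = begin
    length ((pending o ∷ Lr) ʳ++ W)        ≡⟨ length-ʳ++ (pending o ∷ Lr) ⟩
    suc (length Lr) + length W             ≡⟨ +-comm (suc (length Lr)) (length W) ⟩
    length W + suc (length Lr)             ≡⟨ cong (_+ suc (length Lr)) (length-reverse W) ⟨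
    length (reverse W) + suc (length Lr)   ≡⟨ length-++ (reverse W) ⟨
    length end                             ∎
    where open ≡-Reasoning
  tape-end : end ʳ++ (□ ∷ []) ≡ Lr ʳ++ (pending o ∷ W ++ □ ∷ [])
  tape-end = trans (++-ʳ++ (reverse W)) (cong (λ X → Lr ʳ++ (pending o ∷ X)) (reverse-ʳ++ (□ ∷ [])))
  toEnd : Run (carry v) (suc (length Lr)) (Lr ʳ++ (pending o ∷ W)) (carry v) (length end) (end ʳ++ (□ ∷ [])) (length W)
  toEnd = Run-subst refl refl length-end (sym tape-end)
    (Run-cong-end (λ i → sym (cell-ʳ++-∷ʳ-□ Lr (pending o ∷ W) i))
      (scanRight Ordinary carry-skips (pending o ∷ Lr) W ordW))
  append : Run (carry v) (length end) (end ʳ++ (□ ∷ [])) back (length Lr)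
    (Lr ʳ++ (pending o ∷ (reverse W ʳ++ (input v ∷ [])))) (suc (length W))
  append = Run-mono (≤-reflexive (cong suc (length-reverse W)))
    (scanLeft Ordinary back-skips refl (reverse W) (All-ʳ++ ordW []) (pending o) Lr [])
  unmark : Run back (length Lr) (Lr ʳ++ (pending o ∷ (reverse W ʳ++ (input v ∷ [])))) copy (suc (length Lr))
    (Lr ʳ++ (input o ∷ (W ++ input v ∷ []))) 1
  unmark = Run-subst refl refl refl (cong (λ X → Lr ʳ++ (input o ∷ X)) (reverse-ʳ++ (input v ∷ []))) (stepRight Lr _ refl)

-- P is what has been appended so far; K bounds the length of the part of the tape right of the head.
copySweep : ∀ Y → All Ordinary Y → ∀ K Lr P → All Ordinary P → length Y + length P + length (copies Y) ≤ K →
  Run copy (length Lr) (Lr ʳ++ (Y ++ P)) copy (length (map restore Y ʳ++ Lr))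
    (Lr ʳ++ (map restore Y ++ P ++ copies Y)) (length Y * (2 * K + 3))
copySweep []      []          K Lr P _ _ =
  Run-subst refl refl refl (cong (Lr ʳ++_) (sym (++-identityʳ P))) Run-refl
copySweep (y ∷ Y) (ordy ∷ ordY) K Lr P ordP bound =
  Run-trans (Run-subst refl refl refl (cong (λ X → Lr ʳ++ (restore y ∷ X)) (++-assoc Y P (copyOf y)))
              (copyStep ordy K Lr (Y ++ P) (++⁺ ordY ordP) (subst (_≤ K) (sym (length-++ Y)) rest≤)))
            (Run-subst refl refl refl (cong (λ X → Lr ʳ++ (restore y ∷ (map restore Y ++ X))) (++-assoc P (copyOf y) (copies Y)))
              (copySweep Y ordY K (restore y ∷ Lr) (P ++ copyOf y) (++⁺ ordP (copyOf-ordinary y))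
                (subst (λ m → length Y + m + length (copies Y) ≤ K) (sym (length-++ P)) next≤)))
  where
  bound′ : suc (length Y) + length P + (length (copyOf y) + length (copies Y)) ≤ K
  bound′ = subst (λ m → suc (length Y) + length P + m ≤ K) (length-++ (copyOf y)) bound
  rest≤ : length Y + length P ≤ K
  rest≤ = ≤-trans (m≤m+n (length Y + length P) (suc (length (copyOf y) + length (copies Y))))
            (subst (_≤ K) (shuffle (length Y) (length P) (length (copyOf y)) (length (copies Y))) bound′)
    where
    shuffle : ∀ y p a b → suc y + p + (a + b) ≡ y + p + suc (a + b)
    shuffle = solve-∀
  next≤ : length Y + (length P + length (copyOf y)) + length (copies Y) ≤ K
  next≤ = ≤-trans (n≤1+n _)
            (subst (_≤ K) (shuffle (length Y) (length P) (length (copyOf y)) (length (copies Y))) bound′)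
    where
    shuffle : ∀ y p a b → suc y + p + (a + b) ≡ suc (y + (p + a) + b)
    shuffle = solve-∀

restore-input : ∀ xs → map restore (map input xs) ≡ map input xs
restore-input []       = refl
restore-input (x ∷ xs) = cong (input x ∷_) (restore-input xs)

restore-doubled : ∀ ds → map restore (map doubled ds) ≡ map input ds
restore-doubled []       = refl
restore-doubled (d ∷ ds) = cong (input d ∷_) (restore-doubled ds)

copies-++ : ∀ X Y → copies (X ++ Y) ≡ copies X ++ copies Y
copies-++ []      Y = refl
copies-++ (x ∷ X) Y = trans (cong (copyOf x ++_) (copies-++ X Y)) (sym (++-assoc (copyOf x) (copies X) (copies Y)))

copies-input : ∀ xs → copies (map input xs) ≡ []
copies-input []       = refl
copies-input (x ∷ xs) = copies-input xs

copies-doubled : ∀ ds → copies (map doubled ds) ≡ map input ds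
copies-doubled []       = refl
copies-doubled (d ∷ ds) = cong (input d ∷_) (copies-doubled ds)

restore-magnitude : ∀ ds → map restore (map doubled ds ++ doubled semiˢ ∷ []) ≡ map input (ds ++ semiˢ ∷ [])
restore-magnitude ds =
  trans (map-++ restore (map doubled ds) _) (trans (cong (_++ input semiˢ ∷ []) (restore-doubled ds)) (sym (map-++ input ds _)))

copies-magnitude : ∀ ds → copies (map doubled ds ++ doubled semiˢ ∷ []) ≡ map input (ds ++ semiˢ ∷ [])
copies-magnitude ds =
  trans (copies-++ (map doubled ds) _) (trans (cong (_++ input semiˢ ∷ []) (copies-doubled ds)) (sym (map-++ input ds _)))

restore-markedWeight : ∀ w → map restore (markedWeight w) ≡ map input (encℤ w ++ semiˢ ∷ [])
restore-markedWeight (+ n)    = cong (input plusˢ ∷_) (restore-magnitude (encℕ n))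
restore-markedWeight -[1+ n ] = cong (input minusˢ ∷_) (restore-magnitude (encℕ (suc n)))

copies-markedWeight : ∀ w → copies (markedWeight w) ≡ map input (encℤ (ℤ.- w) ++ semiˢ ∷ [])
copies-markedWeight (+ zero)  = refl
copies-markedWeight (+ suc n) = cong (input minusˢ ∷_) (copies-magnitude (encℕ (suc n)))
copies-markedWeight -[1+ n ]  = cong (input plusˢ ∷_) (copies-magnitude (encℕ (suc n)))

restore-swept : ∀ p → map restore (swept p) ≡ map input (encClause (negatedClause p))
restore-swept (c , w) = begin
  map restore (map input (encLits (map negate c)) ++ markedWeight w)
    ≡⟨ map-++ restore (map input (encLits (map negate c))) (markedWeight w) ⟩
  map restore (map input (encLits (map negate c))) ++ map restore (markedWeight w)
    ≡⟨ cong₂ _++_ (restore-input (encLits (map negate c))) (restore-markedWeight w) ⟩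
  map input (encLits (map negate c)) ++ map input (encℤ w ++ semiˢ ∷ [])
    ≡⟨ map-++ input (encLits (map negate c)) _ ⟨
  map input (encClause (negatedClause (c , w))) ∎
  where open ≡-Reasoning

copies-swept : ∀ p → copies (swept p) ≡ map input (encClause (compensatingClause p))
copies-swept (c , w) = begin
  copies (map input (encLits (map negate c)) ++ markedWeight w)
    ≡⟨ copies-++ (map input (encLits (map negate c))) (markedWeight w) ⟩
  copies (map input (encLits (map negate c))) ++ copies (markedWeight w)
    ≡⟨ cong (_++ copies (markedWeight w)) (copies-input (encLits (map negate c))) ⟩
  copies (markedWeight w)
    ≡⟨ copies-markedWeight w ⟩
  map input (encClause (compensatingClause (c , w))) ∎
  where open ≡-Reasoning

restore-sweptAll : ∀ cs → map restore (concat (map swept cs)) ≡ map input (concat (map encClause (map negatedClause cs)))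
restore-sweptAll []       = refl
restore-sweptAll (p ∷ cs) =
  trans (map-++ restore (swept p) _)
    (trans (cong₂ _++_ (restore-swept p) (restore-sweptAll cs)) (sym (map-++ input (encClause (negatedClause p)) _)))

copies-sweptAll : ∀ cs → copies (concat (map swept cs)) ≡ map input (concat (map encClause (map compensatingClause cs)))
copies-sweptAll []       = refl
copies-sweptAll (p ∷ cs) =
  trans (copies-++ (swept p) _)
    (trans (cong₂ _++_ (copies-swept p) (copies-sweptAll cs)) (sym (map-++ input (encClause (compensatingClause p)) _)))

ordinary-input : ∀ xs → All Ordinary (map input xs)
ordinary-input []       = []
ordinary-input (x ∷ xs) = ordinaryInput ∷ ordinary-input xs

ordinary-magnitude : ∀ ds → All Ordinary (map doubled ds ++ doubled semiˢ ∷ [])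
ordinary-magnitude []       = ordinaryMarked ∷ []
ordinary-magnitude (d ∷ ds) = ordinaryMarked ∷ ordinary-magnitude ds

ordinary-markedWeight : ∀ w → All Ordinary (markedWeight w)
ordinary-markedWeight (+ n)    = ordinaryMarked ∷ ordinary-magnitude (encℕ n)
ordinary-markedWeight -[1+ n ] = ordinaryMarked ∷ ordinary-magnitude (encℕ (suc n))

ordinary-sweptAll : ∀ cs → All Ordinary (concat (map swept cs))
ordinary-sweptAll []             = []
ordinary-sweptAll ((c , w) ∷ cs) =
  ++⁺ (++⁺ (ordinary-input (encLits (map negate c))) (ordinary-markedWeight w)) (ordinary-sweptAll cs)

length-encLits-negate : ∀ c → length (encLits (map negate c)) ≡ length (encLits c)
length-encLits-negate []            = refl
length-encLits-negate ((v , b) ∷ c) =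
  trans (length-++ (encLit (v , not b)))
    (trans (cong (λ m → length (encLit (v , b)) + m) (length-encLits-negate c)) (sym (length-++ (encLit (v , b)))))

length-magnitude : ∀ ds → length (map doubled ds ++ doubled semiˢ ∷ []) ≡ length (ds ++ semiˢ ∷ [])
length-magnitude []       = refl
length-magnitude (d ∷ ds) = cong suc (length-magnitude ds)

length-markedWeight : ∀ w → length (markedWeight w) ≡ length (encℤ w ++ semiˢ ∷ [])
length-markedWeight (+ n)    = cong suc (length-magnitude (encℕ n))
length-markedWeight -[1+ n ] = cong suc (length-magnitude (encℕ (suc n)))

length-swept : ∀ p → length (swept p) ≡ length (encClause p)
length-swept (c , w) =
  trans (length-++ (map input (encLits (map negate c))))
    (trans (cong₂ _+_ (trans (length-map input (encLits (map negate c))) (length-encLits-negate c)) (length-markedWeight w))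
      (sym (length-++ (encLits c))))

length-sweptAll : ∀ cs → length (concat (map swept cs)) ≡ length (concat (map encClause cs))
length-sweptAll []       = refl
length-sweptAll (p ∷ cs) =
  trans (length-++ (swept p)) (trans (cong₂ _+_ (length-swept p) (length-sweptAll cs)) (sym (length-++ (encClause p))))

data IsInput : TapeSym → Set where
  isInput : ∀ {s} → IsInput (input s)

all-isInput : ∀ xs → All IsInput (map input xs)
all-isInput []       = []
all-isInput (x ∷ xs) = isInput ∷ all-isInput xs

seekEnd-skips : ∀ {s} → IsInput s → transition seekEnd s ≡ just (seekEnd , s , right)
seekEnd-skips isInput = refl

copy-skips : ∀ {s} → IsInput s → transition copy s ≡ just (copy , s , right)
copy-skips isInput = refl

run-halted : ∀ {c} n → step machine c ≡ nothing → run machine n c ≡ just c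
run-halted {c} n halts with step machine c | halts
... | nothing | _ = refl
... | just _  | ()

run-suc : ∀ {c c'} n → step machine c ≡ just c' → run machine (suc n) c ≡ run machine n c'
run-suc {c} n e with step machine c | e
... | just _  | refl = refl
... | nothing | ()

run-Steps : ∀ {k c c'} → Steps k c c' → step machine c' ≡ nothing → ∀ n → k ≤ n → run machine n c ≡ just c'
run-Steps done       halts n       _         = run-halted n halts
run-Steps (more e s) halts (suc n) (s≤s k≤n) = trans (run-suc n e) (run-Steps s halts n k≤n)

Represents-inputTape : ∀ w → Represents (inputTape machine w) (map input w)
Represents-inputTape []      i       = refl
Represents-inputTape (a ∷ w) zero    = refl
Represents-inputTape (a ∷ w) (suc i) = Represents-inputTape w i

cell-map-input : ∀ w (i : Fin (length w)) → cell (map input w) (toℕ i) ≡ input (lookup w i)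
cell-map-input (a ∷ w) zero    = refl
cell-map-input (a ∷ w) (suc i) = cell-map-input w i

cell-map-input-length : ∀ w → cell (map input w) (length w) ≡ □
cell-map-input-length []      = refl
cell-map-input-length (a ∷ w) = cell-map-input-length w

Represents⇒Outputs : ∀ t w → Represents t (map input w) → Outputs machine t w
Represents⇒Outputs t w rep =
  (λ i → trans (rep (toℕ i)) (cong encodeSym (cell-map-input w i))) ,
  trans (rep (length w)) (cong encodeSym (cell-map-input-length w))

Run⇒run : ∀ {q B} w w' n → Run seekEnd 0 (map input w) q (length w') (map input w') B →
  transition q □ ≡ nothing → B ≤ n →
  Σ (Config machine) λ c → run machine n (initial machine w) ≡ just c × Outputs machine (Config.tape c) w'
Run⇒run {q} w w' n r halts B≤n =
  let (k , t , steps , rep , k≤B) = simulate r (inputTape machine w) (Represents-inputTape w)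
      blankAtEnd = trans (rep (length w')) (cong encodeSym (cell-map-input-length w'))
  in cfg (encodeState q) (length w') t
   , run-Steps steps (step-halt (trans (cong (δ machine (encodeState q)) blankAtEnd)
                                       (trans (δ-encode q □) (cong encodeAction halts))))
                     n (≤-trans k≤B B≤n)
   , Represents⇒Outputs t w' rep

map-input-encClauses-++ : ∀ cs ds → map input (concat (map encClause (cs ++ ds)))
  ≡ map input (concat (map encClause cs)) ++ map input (concat (map encClause ds))
map-input-encClauses-++ cs ds = begin
  map input (concat (map encClause (cs ++ ds)))
    ≡⟨ cong (λ X → map input (concat X)) (map-++ encClause cs ds) ⟩
  map input (concat (map encClause cs ++ map encClause ds))
    ≡⟨ cong (map input) (concat-++ (map encClause cs) (map encClause ds)) ⟨
  map input (concat (map encClause cs) ++ concat (map encClause ds))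
    ≡⟨ map-++ input (concat (map encClause cs)) _ ⟩
  map input (concat (map encClause cs)) ++ map input (concat (map encClause ds)) ∎
  where open ≡-Reasoning

module Computation (x : Instance) where
  cs : List (Clause × ℤ)
  cs = clauses x

  n : ℕ
  n = length (enc x)

  threshold clauseBlock markedBlock beforeClauses : List TapeSym
  threshold     = map input (encℕ (α x))
  clauseBlock   = map input (concat (map encClause cs))
  markedBlock   = concat (map swept cs)
  beforeClauses = input hashˢ ∷ (threshold ʳ++ [])

  input-enc : map input (enc x) ≡ threshold ++ input hashˢ ∷ clauseBlock
  input-enc = map-++ input (encℕ (α x)) (hashˢ ∷ concat (map encClause cs))

  clauseBlock< : suc (length clauseBlock) ≤ n
  clauseBlock< = subst (suc (length clauseBlock) ≤_)
    (sym (trans (sym (length-map input (enc x))) (trans (cong length input-enc) (length-++ threshold))))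
    (m≤n+m (suc (length clauseBlock)) (length threshold))

  sweepStart : ℕ
  sweepStart = length (threshold ʳ++ []) + length (clauseBlock ++ □ ∷ [])

  toEnd : Run seekEnd 0 (map input (enc x)) seekEnd sweepStart (beforeClauses ʳ++ ((clauseBlock ++ □ ∷ []) ++ [])) n
  toEnd = Run-subst refl refl endHead (cong (beforeClauses ʳ++_) (sym (++-identityʳ _)))
    (Run-cong-end (λ i → sym (cell-ʳ++-∷ʳ-□ beforeClauses clauseBlock i))
      (Run-subst refl refl refl (trans input-enc (sym (ʳ++-ʳ++ threshold)))
        (Run-mono (≤-reflexive (length-map input (enc x)))
          (scanRight IsInput seekEnd-skips [] (map input (enc x)) (all-isInput (enc x))))))
    where
    endHead : length (map input (enc x)) ≡ sweepStart
    endHead = trans (cong length input-enc) (trans (length-++ threshold)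
      (cong₂ _+_ (sym (trans (length-ʳ++ threshold) (+-identityʳ _)))
                 (trans (+-comm 1 _) (sym (length-++ clauseBlock)))))

  firstSweep : Run seekEnd sweepStart (beforeClauses ʳ++ ((clauseBlock ++ □ ∷ []) ++ []))
                 copy (length beforeClauses) (beforeClauses ʳ++ markedBlock) (length (clauseBlock ++ □ ∷ []) + 1)
  firstSweep = Run-trans
    (sweepRun (LeftSweep-++ {X₁ = clauseBlock} (LeftSweep-step refl) (sweep-clauses cs)) beforeClauses [] _ refl)
    (Run-cong-end (λ i → trans (cong (λ X → cell (beforeClauses ʳ++ X) i) (++-identityʳ _))
                               (cell-ʳ++-∷ʳ-□ beforeClauses markedBlock i))
      (stepRight (threshold ʳ++ []) _ refl))

  restored appended : List TapeSym
  restored = map restore markedBlock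
  appended = copies markedBlock

  markedBlock≤ : length markedBlock ≤ n
  markedBlock≤ = subst (_≤ n) (sym (trans (length-sweptAll cs) (sym (length-map input (concat (map encClause cs))))))
                   (≤-trans (n≤1+n (length clauseBlock)) clauseBlock<)

  secondSweep : Run copy (length beforeClauses) (beforeClauses ʳ++ markedBlock)
                  copy (length (restored ʳ++ beforeClauses)) ((restored ʳ++ beforeClauses) ʳ++ appended)
                  (length markedBlock * (2 * (2 * n) + 3))
  secondSweep = Run-subst refl (cong (beforeClauses ʳ++_) (++-identityʳ markedBlock)) refl (sym (ʳ++-ʳ++ restored))
    (copySweep markedBlock (ordinary-sweptAll cs) (2 * n) beforeClauses [] [] bound)
    where
    bound : length markedBlock + 0 + length appended ≤ 2 * n
    bound = ≤-trans (+-mono-≤ (+-mono-≤ markedBlock≤ z≤n) (≤-trans (length-copies markedBlock) markedBlock≤))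
                    (≤-reflexive (double n))
      where
      double : ∀ n → n + 0 + n ≡ 2 * n
      double = solve-∀

  output : (restored ʳ++ beforeClauses) ʳ++ appended ≡ map input (enc (cnf⇒dnf x))
  output = begin
    (restored ʳ++ beforeClauses) ʳ++ appended
      ≡⟨ ʳ++-ʳ++ restored ⟩
    beforeClauses ʳ++ (restored ++ appended)
      ≡⟨ ʳ++-ʳ++ threshold ⟩
    threshold ++ input hashˢ ∷ (restored ++ appended)
      ≡⟨ cong (λ X → threshold ++ input hashˢ ∷ X) (cong₂ _++_ (restore-sweptAll cs) (copies-sweptAll cs)) ⟩
    threshold ++ input hashˢ ∷ (map input (concat (map encClause (map negatedClause cs)))
                                 ++ map input (concat (map encClause (map compensatingClause cs))))
      ≡⟨ cong (λ X → threshold ++ input hashˢ ∷ X) (map-input-encClauses-++ (map negatedClause cs) _) ⟨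
    threshold ++ input hashˢ ∷ map input (concat (map encClause (clauses (cnf⇒dnf x))))
      ≡⟨ map-++ input (encℕ (α x)) _ ⟨
    map input (enc (cnf⇒dnf x)) ∎
    where open ≡-Reasoning

  finalScan : Run copy (length (restored ʳ++ beforeClauses)) ((restored ʳ++ beforeClauses) ʳ++ appended)
                copy (length (enc (cnf⇒dnf x))) (map input (enc (cnf⇒dnf x))) (length appended)
  finalScan = Run-subst refl refl (trans (cong length output) (length-map input (enc (cnf⇒dnf x)))) output
    (scanRight IsInput copy-skips (restored ʳ++ beforeClauses) appended
      (subst (All IsInput) (sym (copies-sweptAll cs)) (all-isInput _)))

  steps≤ : n + (length (clauseBlock ++ □ ∷ []) + 1) + length markedBlock * (2 * (2 * n) + 3) + length appended
           ≤ 4 * suc n ^ 2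
  steps≤ = ≤-trans
    (+-mono-≤ (+-mono-≤ (+-mono-≤ (≤-refl {n}) (+-mono-≤ clauseBlock+□≤ (≤-refl {1})))
                        (*-mono-≤ markedBlock≤ (≤-refl {2 * (2 * n) + 3})))
              (≤-trans (length-copies markedBlock) markedBlock≤))
    (subst (n + (n + 1) + n * (2 * (2 * n) + 3) + n ≤_) (polynomial n) (m≤m+n _ (2 * n + 3)))
    where
    clauseBlock+□≤ : length (clauseBlock ++ □ ∷ []) ≤ n
    clauseBlock+□≤ = subst (_≤ n) (trans (+-comm 1 _) (sym (length-++ clauseBlock))) clauseBlock<
    polynomial : ∀ n → n + (n + 1) + n * (2 * (2 * n) + 3) + n + (2 * n + 3) ≡ 4 * (suc n * (suc n * 1))
    polynomial = solve-∀

  runs : Σ (Config machine) λ c →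
    run machine (4 * suc n ^ 2) (initial machine (enc x)) ≡ just c
    × Outputs machine (Config.tape c) (enc (cnf⇒dnf x))
  runs = Run⇒run (enc x) (enc (cnf⇒dnf x)) (4 * suc n ^ 2)
    (Run-trans (Run-trans (Run-trans toEnd firstSweep) secondSweep) finalScan) refl steps≤

lemma24 : FPTReduction ABS-CNF ABS-DNF
lemma24 = record
  { R           = cnf⇒dnf
  ; sound       = cnf⇒dnf-sound
  ; complete    = cnf⇒dnf-complete
  ; g           = λ k → k
  ; param-bound = λ x → ≤-reflexive (param-cnf⇒dnf x)
  ; f           = λ _ → 4
  ; c           = 2
  ; M           = machine
  ; runs        = Computation.runs
  }
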